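{- For integers $k\ge1$ let $c^{(k)}_{l,m}$ ($1\le l,m\le k$) be the unique coefficients with $(xy)^{\underline{k}} = \sum_{l,m=1}^k c^{(k)}_{l,m}\, x^{\underline{l}}\, y^{\underline{m}}$, and set $c^{(k)}_{l,m}=0$ whenever $l$ or $m$ lies outside $\{1,\dots,k\}$. Then for all integers $k\ge1$ and $0\le l,m\le k$, \[ c^{(k+1)}_{l+1,m+1} = c^{(k)}_{l,m}+(l+1)c^{(k)}_{l+1,m}+(m+1)c^{(k)}_{l,m+1}+\big((l+1)(m+1)-k\big)c^{(k)}_{l+1,m+1}. \]
   Context: $x^{\underline{n}}=x(x-1)\cdots(x-n+1)$ is the falling factorial power. -}

module Defs where

open import Data.Nat as ℕ using (ℕ; zero; suc)
open import Data.Integer using (ℤ; +_; _+_; _*_; _-_)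
open import Data.Product using (_×_)
open import Data.Sum using (_⊎_)
open import Relation.Binary.PropositionalEquality using (_≡_)

falling : ℤ → ℕ → ℤ
falling x zero    = + 1
falling x (suc n) = falling x n * (x - + n)

Σ₁ : ℕ → (ℕ → ℤ) → ℤ
Σ₁ zero    f = + 0
Σ₁ (suc n) f = Σ₁ n f + f (suc n)

-- c is the family c^{(k)}_{l,m} (as  c k l m) of coefficients of the expansion
--   (xy)^{\underline{k}} = Σ_{l,m=1}^{k} c^{(k)}_{l,m} x^{\underline{l}} y^{\underline{m}}
-- for every k ≥ 1, extended by zero outside 1 ≤ l, m ≤ k.
-- (Such coefficients exist and are unique, so this determines c for k ≥ 1.)
IsFallingProductCoeffs : (ℕ → ℕ → ℕ → ℤ) → Set
IsFallingProductCoeffs c =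
  (∀ k → 1 ℕ.≤ k → ∀ (x y : ℤ) →
     falling (x * y) k ≡ Σ₁ k (λ l → Σ₁ k (λ m → c k l m * falling x l * falling y m)))
  × (∀ k → 1 ℕ.≤ k → ∀ l m → (l ≡ 0 ⊎ k ℕ.< l ⊎ m ≡ 0 ⊎ k ℕ.< m) → c k l m ≡ + 0)

-- Multiplying by xy - k and writing xy = ((x - l) + l)((y - m) + m) turns each product
-- x^{\underline l} y^{\underline m} (xy - k) into the four falling products
-- x^{\underline{l+1}} y^{\underline{m+1}}, l x^{\underline l} y^{\underline{m+1}},
-- m x^{\underline{l+1}} y^{\underline m} and (lm - k) x^{\underline l} y^{\underline m}.
-- Reindexing gives an expansion of (xy)^{\underline{k+1}} whose coefficients are the
-- right-hand side of the recurrence, and these must agree with c^{(k+1)}: the products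
-- x^{\underline l} y^{\underline m} are linearly independent as functions on ℕ × ℕ,
-- since evaluating at x = a kills every x^{\underline l} with l > a and not x^{\underline a}.
module Submission where

open import Defs
open import Data.Nat as ℕ using (ℕ; suc; zero; z≤n; s≤s)
open import Data.Nat.Induction using (<-rec)
import Data.Nat.Properties as ℕ
open import Data.Integer using (ℤ; +_; 0ℤ; _+_; _*_; _-_)
import Data.Integer.Properties as ℤ
open import Data.Integer.Tactic.RingSolver using (solve-∀)
open import Data.Product using (_,_)
open import Data.Sum using (_⊎_; inj₁; inj₂)
open import Function using (_∘_)
open import Relation.Binary.PropositionalEquality
  using (_≡_; _≢_; refl; sym; trans; cong; cong₂; module ≡-Reasoning)
open import Relation.Nullary using (contradiction)
open import Relation.Binary.Definitions using (tri<; tri≈; tri>)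

Σ₁-cong : ∀ n {f g : ℕ → ℤ} → (∀ i → f i ≡ g i) → Σ₁ n f ≡ Σ₁ n g
Σ₁-cong zero    f≡g = refl
Σ₁-cong (suc n) f≡g = cong₂ _+_ (Σ₁-cong n f≡g) (f≡g (suc n))

Σ₁-zero : ∀ n (f : ℕ → ℤ) → (∀ i → 1 ℕ.≤ i → i ℕ.≤ n → f i ≡ 0ℤ) → Σ₁ n f ≡ 0ℤ
Σ₁-zero zero    f f≡0 = refl
Σ₁-zero (suc n) f f≡0 =
  cong₂ _+_ (Σ₁-zero n f (λ i 1≤i i≤n → f≡0 i 1≤i (ℕ.m≤n⇒m≤1+n i≤n)))
            (f≡0 (suc n) (s≤s z≤n) ℕ.≤-refl)

Σ₁-single : ∀ n (f : ℕ → ℤ) {j} → 1 ℕ.≤ j → j ℕ.≤ n →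
            (∀ i → 1 ℕ.≤ i → i ℕ.≤ n → i ≢ j → f i ≡ 0ℤ) → Σ₁ n f ≡ f j
Σ₁-single zero    f (s≤s _) ()
Σ₁-single (suc n) f {j} 1≤j j≤1+n f≡0 with ℕ.m≤n⇒m<n∨m≡n j≤1+n
... | inj₁ (s≤s j≤n) =
  trans (cong₂ _+_ (Σ₁-single n f 1≤j j≤n λ i 1≤i i≤n → f≡0 i 1≤i (ℕ.m≤n⇒m≤1+n i≤n))
                   (f≡0 (suc n) (s≤s z≤n) ℕ.≤-refl (ℕ.>⇒≢ (s≤s j≤n))))
        (ℤ.+-identityʳ (f j))
... | inj₂ refl =
  trans (cong (_+ f (suc n)) (Σ₁-zero n f λ i 1≤i i≤n → f≡0 i 1≤i (ℕ.m≤n⇒m≤1+n i≤n) (ℕ.<⇒≢ (s≤s i≤n))))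
        (ℤ.+-identityˡ (f (suc n)))

Σ₁-+ : ∀ n (f g : ℕ → ℤ) → Σ₁ n (λ i → f i + g i) ≡ Σ₁ n f + Σ₁ n g
Σ₁-+ zero    f g = refl
Σ₁-+ (suc n) f g = trans (cong (_+ (f (suc n) + g (suc n))) (Σ₁-+ n f g))
                         (interchange (Σ₁ n f) (Σ₁ n g) (f (suc n)) (g (suc n)))
  where
  interchange : ∀ a b c d → (a + b) + (c + d) ≡ (a + c) + (b + d)
  interchange = solve-∀

Σ₁-- : ∀ n (f g : ℕ → ℤ) → Σ₁ n (λ i → f i - g i) ≡ Σ₁ n f - Σ₁ n g
Σ₁-- zero    f g = refl
Σ₁-- (suc n) f g = trans (cong (_+ (f (suc n) - g (suc n))) (Σ₁-- n f g))
                         (interchange (Σ₁ n f) (Σ₁ n g) (f (suc n)) (g (suc n)))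
  where
  interchange : ∀ a b c d → (a - b) + (c - d) ≡ (a + c) - (b + d)
  interchange = solve-∀

Σ₁-*ʳ : ∀ n (f : ℕ → ℤ) a → Σ₁ n (λ i → f i * a) ≡ Σ₁ n f * a
Σ₁-*ʳ zero    f a = refl
Σ₁-*ʳ (suc n) f a = trans (cong (_+ f (suc n) * a) (Σ₁-*ʳ n f a))
                          (sym (ℤ.*-distribʳ-+ a (Σ₁ n f) (f (suc n))))

Σ₁-dropFirst : ∀ n (f : ℕ → ℤ) → f 1 ≡ 0ℤ → Σ₁ (suc n) f ≡ Σ₁ n (f ∘ suc)
Σ₁-dropFirst zero    f f1≡0 = trans (ℤ.+-identityˡ (f 1)) f1≡0
Σ₁-dropFirst (suc n) f f1≡0 = cong (_+ f (suc (suc n))) (Σ₁-dropFirst n f f1≡0)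

Σ₁-dropLast : ∀ n (f : ℕ → ℤ) → f (suc n) ≡ 0ℤ → Σ₁ (suc n) f ≡ Σ₁ n f
Σ₁-dropLast n f fn≡0 = trans (cong (λ s → Σ₁ n f + s) fn≡0) (ℤ.+-identityʳ (Σ₁ n f))

ΣΣ : ℕ → (ℕ → ℕ → ℤ) → ℤ
ΣΣ n f = Σ₁ n (λ l → Σ₁ n (f l))

ΣΣ-cong : ∀ n {f g : ℕ → ℕ → ℤ} → (∀ l m → f l m ≡ g l m) → ΣΣ n f ≡ ΣΣ n g
ΣΣ-cong n f≡g = Σ₁-cong n (λ l → Σ₁-cong n (f≡g l))

ΣΣ-+ : ∀ n (f g : ℕ → ℕ → ℤ) → ΣΣ n (λ l m → f l m + g l m) ≡ ΣΣ n f + ΣΣ n g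
ΣΣ-+ n f g = trans (Σ₁-cong n (λ l → Σ₁-+ n (f l) (g l))) (Σ₁-+ n _ _)

ΣΣ-+₄ : ∀ n (f g h u : ℕ → ℕ → ℤ) →
        ΣΣ n (λ l m → f l m + g l m + h l m + u l m) ≡ ΣΣ n f + ΣΣ n g + ΣΣ n h + ΣΣ n u
ΣΣ-+₄ n f g h u =
  trans (ΣΣ-+ n _ u) (cong (_+ ΣΣ n u) (trans (ΣΣ-+ n _ h) (cong (_+ ΣΣ n h) (ΣΣ-+ n f g))))

ΣΣ-- : ∀ n (f g : ℕ → ℕ → ℤ) → ΣΣ n (λ l m → f l m - g l m) ≡ ΣΣ n f - ΣΣ n g
ΣΣ-- n f g = trans (Σ₁-cong n (λ l → Σ₁-- n (f l) (g l))) (Σ₁-- n _ _)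

ΣΣ-*ʳ : ∀ n (f : ℕ → ℕ → ℤ) a → ΣΣ n (λ l m → f l m * a) ≡ ΣΣ n f * a
ΣΣ-*ʳ n f a = trans (Σ₁-cong n (λ l → Σ₁-*ʳ n (f l) a)) (Σ₁-*ʳ n _ a)

expansion : ℕ → (ℕ → ℕ → ℤ) → ℤ → ℤ → ℤ
expansion n a x y = ΣΣ n (λ l m → a l m * falling x l * falling y m)

falling-vanishes : ∀ {a l} → a ℕ.< l → falling (+ a) l ≡ 0ℤ
falling-vanishes {a} {suc l} (s≤s a≤l) with ℕ.m≤n⇒m<n∨m≡n a≤l
... | inj₁ a<l  = trans (cong (_* (+ a - + l)) (falling-vanishes a<l)) (ℤ.*-zeroˡ (+ a - + l))
... | inj₂ refl = trans (cong (falling (+ a) a *_) (ℤ.i≡j⇒i-j≡0 {+ a} refl)) (ℤ.*-zeroʳ (falling (+ a) a))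

falling-nonzero : ∀ {a n} → n ℕ.≤ a → falling (+ a) n ≢ 0ℤ
falling-nonzero {a} {zero}  _   ()
falling-nonzero {a} {suc n} n<a eq with ℤ.i*j≡0⇒i≡0∨j≡0 (falling (+ a) n) eq
... | inj₁ falling≡0 = falling-nonzero (ℕ.<⇒≤ n<a) falling≡0
... | inj₂ a-n≡0     = ℕ.>⇒≢ n<a (ℤ.+-injective (ℤ.i-j≡0⇒i≡j (+ a) (+ n) a-n≡0))

i≡0⇒i*j≡0 : ∀ {i} j → i ≡ 0ℤ → i * j ≡ 0ℤ
i≡0⇒i*j≡0 j refl = ℤ.*-zeroˡ j

falling-independent : ∀ n (e : ℕ → ℤ) → (∀ a → Σ₁ n (λ l → e l * falling (+ a) l) ≡ 0ℤ) →
                      ∀ i → 1 ℕ.≤ i → i ℕ.≤ n → e i ≡ 0ℤ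
falling-independent n e sum≡0 = <-rec P step
  where
  P : ℕ → Set
  P i = 1 ℕ.≤ i → i ℕ.≤ n → e i ≡ 0ℤ

  offDiagonal : ∀ i → (∀ {j} → j ℕ.< i → P j) →
                ∀ l → 1 ℕ.≤ l → l ℕ.≤ n → l ≢ i → e l * falling (+ i) l ≡ 0ℤ
  offDiagonal i below l 1≤l l≤n l≢i with ℕ.<-cmp l i
  ... | tri< l<i _ _ = i≡0⇒i*j≡0 (falling (+ i) l) (below l<i 1≤l l≤n)
  ... | tri≈ _ l≡i _ = contradiction l≡i l≢i
  ... | tri> _ _ i<l = trans (cong (e l *_) (falling-vanishes i<l)) (ℤ.*-zeroʳ (e l))

  diagonal : ∀ i → (∀ {j} → j ℕ.< i → P j) → 1 ℕ.≤ i → i ℕ.≤ n → e i * falling (+ i) i ≡ 0ℤ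
  diagonal i below 1≤i i≤n = trans (sym (Σ₁-single n _ 1≤i i≤n (offDiagonal i below))) (sum≡0 i)

  step : ∀ i → (∀ {j} → j ℕ.< i → P j) → P i
  step i below 1≤i i≤n with ℤ.i*j≡0⇒i≡0∨j≡0 (e i) (diagonal i below 1≤i i≤n)
  ... | inj₁ eᵢ≡0      = eᵢ≡0
  ... | inj₂ falling≡0 = contradiction falling≡0 (falling-nonzero {i} ℕ.≤-refl)

falling-independent₂ : ∀ n (e : ℕ → ℕ → ℤ) → (∀ a b → expansion n e (+ a) (+ b) ≡ 0ℤ) →
                       ∀ l m → 1 ℕ.≤ l → l ℕ.≤ n → 1 ℕ.≤ m → m ℕ.≤ n → e l m ≡ 0ℤ
falling-independent₂ n e expansion≡0 l m 1≤l l≤n 1≤m m≤n =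
  falling-independent n (e l) (λ b → rows≡0 b l 1≤l l≤n) m 1≤m m≤n
  where
  row : ℕ → ℕ → ℤ
  row b l = Σ₁ n (λ m → e l m * falling (+ b) m)

  sumRows : ∀ a b → Σ₁ n (λ l → row b l * falling (+ a) l) ≡ expansion n e (+ a) (+ b)
  sumRows a b = Σ₁-cong n λ l →
    trans (sym (Σ₁-*ʳ n _ (falling (+ a) l)))
          (Σ₁-cong n λ m → swap (e l m) (falling (+ b) m) (falling (+ a) l))
    where
    swap : ∀ u v w → u * v * w ≡ u * w * v
    swap = solve-∀

  rows≡0 : ∀ b l → 1 ℕ.≤ l → l ℕ.≤ n → row b l ≡ 0ℤ
  rows≡0 b = falling-independent n (row b) λ a → trans (sumRows a b) (expansion≡0 a b)

expansion-injective : ∀ n (c d : ℕ → ℕ → ℤ) →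
                      (∀ a b → expansion n c (+ a) (+ b) ≡ expansion n d (+ a) (+ b)) →
                      ∀ l m → 1 ℕ.≤ l → l ℕ.≤ n → 1 ℕ.≤ m → m ℕ.≤ n → c l m ≡ d l m
expansion-injective n c d c≡d l m 1≤l l≤n 1≤m m≤n =
  ℤ.i-j≡0⇒i≡j (c l m) (d l m)
    (falling-independent₂ n (λ l m → c l m - d l m) difference≡0 l m 1≤l l≤n 1≤m m≤n)
  where
  distrib : ∀ u v p q → (u - v) * p * q ≡ u * p * q - v * p * q
  distrib = solve-∀

  difference≡0 : ∀ a b → expansion n (λ l m → c l m - d l m) (+ a) (+ b) ≡ 0ℤ
  difference≡0 a b = begin
    expansion n (λ l m → c l m - d l m) (+ a) (+ b)
      ≡⟨ ΣΣ-cong n (λ l m → distrib (c l m) (d l m) (falling (+ a) l) (falling (+ b) m)) ⟩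
    ΣΣ n (λ l m → c l m * falling (+ a) l * falling (+ b) m - d l m * falling (+ a) l * falling (+ b) m)
      ≡⟨ ΣΣ-- n _ _ ⟩
    expansion n c (+ a) (+ b) - expansion n d (+ a) (+ b)
      ≡⟨ ℤ.i≡j⇒i-j≡0 (c≡d a b) ⟩
    0ℤ ∎
    where open ≡-Reasoning

falling-*[xy-t] : ∀ x y l m t →
  falling x l * falling y m * (x * y - t)
    ≡ falling x (suc l) * falling y (suc m) + + l * falling x l * falling y (suc m)
      + + m * falling x (suc l) * falling y m + (+ l * + m - t) * falling x l * falling y m
falling-*[xy-t] x y l m t = identity (falling x l) (falling y m) x y (+ l) (+ m) t
  where
  identity : ∀ X Y x y l m t →
    X * Y * (x * y - t)
      ≡ X * (x - l) * (Y * (y - m)) + l * X * (Y * (y - m)) + m * (X * (x - l)) * Y + (l * m - t) * X * Y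
  identity = solve-∀

Supported : ℕ → (ℕ → ℕ → ℤ) → Set
Supported n C = ∀ l m → (l ≡ 0 ⊎ n ℕ.< l ⊎ m ≡ 0 ⊎ n ℕ.< m) → C l m ≡ 0ℤ

module _ {n : ℕ} {C : ℕ → ℕ → ℤ} (supported : Supported n C) (F : ℕ → ℕ → ℤ) where

  private
    firstRow : ∀ m → C 0 m ≡ 0ℤ
    firstRow m = supported 0 m (inj₁ refl)

    lastRow : ∀ m → C (suc n) m ≡ 0ℤ
    lastRow m = supported (suc n) m (inj₂ (inj₁ ℕ.≤-refl))

    firstColumn : ∀ l → C l 0 ≡ 0ℤ
    firstColumn l = supported l 0 (inj₂ (inj₂ (inj₁ refl)))

    lastColumn : ∀ l → C l (suc n) ≡ 0ℤ
    lastColumn l = supported l (suc n) (inj₂ (inj₂ (inj₂ ℕ.≤-refl)))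

  ΣΣ-shift-both : ΣΣ (suc n) (λ L M → C (L ℕ.∸ 1) (M ℕ.∸ 1) * F L M) ≡ ΣΣ n (λ l m → C l m * F (suc l) (suc m))
  ΣΣ-shift-both =
    trans (Σ₁-dropFirst n _ (Σ₁-zero (suc n) _ λ M _ _ → i≡0⇒i*j≡0 (F 1 M) (firstRow (M ℕ.∸ 1))))
          (Σ₁-cong n λ l → Σ₁-dropFirst n _ (i≡0⇒i*j≡0 (F (suc l) 1) (firstColumn l)))

  ΣΣ-shift-column : ΣΣ (suc n) (λ L M → C L (M ℕ.∸ 1) * F L M) ≡ ΣΣ n (λ l m → C l m * F l (suc m))
  ΣΣ-shift-column =
    trans (Σ₁-dropLast n _ (Σ₁-zero (suc n) _ λ M _ _ → i≡0⇒i*j≡0 (F (suc n) M) (lastRow (M ℕ.∸ 1))))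
          (Σ₁-cong n λ l → Σ₁-dropFirst n _ (i≡0⇒i*j≡0 (F l 1) (firstColumn l)))

  ΣΣ-shift-row : ΣΣ (suc n) (λ L M → C (L ℕ.∸ 1) M * F L M) ≡ ΣΣ n (λ l m → C l m * F (suc l) m)
  ΣΣ-shift-row =
    trans (Σ₁-dropFirst n _ (Σ₁-zero (suc n) _ λ M _ _ → i≡0⇒i*j≡0 (F 1 M) (firstRow M)))
          (Σ₁-cong n λ l → Σ₁-dropLast n _ (i≡0⇒i*j≡0 (F (suc l) (suc n)) (lastColumn l)))

  ΣΣ-shrink : ΣΣ (suc n) (λ L M → C L M * F L M) ≡ ΣΣ n (λ l m → C l m * F l m)
  ΣΣ-shrink =
    trans (Σ₁-dropLast n _ (Σ₁-zero (suc n) _ λ M _ _ → i≡0⇒i*j≡0 (F (suc n) M) (lastRow M)))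
          (Σ₁-cong n λ l → Σ₁-dropLast n _ (i≡0⇒i*j≡0 (F l (suc n)) (lastColumn l)))

coeffs*[xy-t] : ℤ → (ℕ → ℕ → ℤ) → ℕ → ℕ → ℤ
coeffs*[xy-t] t C L M =
  C (L ℕ.∸ 1) (M ℕ.∸ 1) + + L * C L (M ℕ.∸ 1) + + M * C (L ℕ.∸ 1) M + (+ L * + M - t) * C L M

expansion-*[xy-t] : ∀ t {n C} → Supported n C → ∀ x y →
                    expansion n C x y * (x * y - t) ≡ expansion (suc n) (coeffs*[xy-t] t C) x y
expansion-*[xy-t] t {n} {C} supported x y = begin
  expansion n C x y * (x * y - t)
    ≡⟨ sym (ΣΣ-*ʳ n _ (x * y - t)) ⟩
  ΣΣ n (λ l m → C l m * X l * Y m * (x * y - t))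
    ≡⟨ ΣΣ-cong n expand ⟩
  ΣΣ n (λ l m → C l m * F₁ (suc l) (suc m) + C l m * F₂ l (suc m) + C l m * F₃ (suc l) m + C l m * F₄ l m)
    ≡⟨ ΣΣ-+₄ n _ _ _ _ ⟩
  ΣΣ n (λ l m → C l m * F₁ (suc l) (suc m)) + ΣΣ n (λ l m → C l m * F₂ l (suc m))
    + ΣΣ n (λ l m → C l m * F₃ (suc l) m) + ΣΣ n (λ l m → C l m * F₄ l m)
    ≡⟨ sym (cong₂ _+_ (cong₂ _+_ (cong₂ _+_ (ΣΣ-shift-both supported F₁) (ΣΣ-shift-column supported F₂))
                                 (ΣΣ-shift-row supported F₃))
                      (ΣΣ-shrink supported F₄)) ⟩
  ΣΣ (suc n) (λ L M → C (L ℕ.∸ 1) (M ℕ.∸ 1) * F₁ L M) + ΣΣ (suc n) (λ L M → C L (M ℕ.∸ 1) * F₂ L M)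
    + ΣΣ (suc n) (λ L M → C (L ℕ.∸ 1) M * F₃ L M) + ΣΣ (suc n) (λ L M → C L M * F₄ L M)
    ≡⟨ sym (ΣΣ-+₄ (suc n) _ _ _ _) ⟩
  ΣΣ (suc n) (λ L M → C (L ℕ.∸ 1) (M ℕ.∸ 1) * F₁ L M + C L (M ℕ.∸ 1) * F₂ L M
                      + C (L ℕ.∸ 1) M * F₃ L M + C L M * F₄ L M)
    ≡⟨ ΣΣ-cong (suc n) collect ⟩
  expansion (suc n) (coeffs*[xy-t] t C) x y ∎
  where
  open ≡-Reasoning
  X Y : ℕ → ℤ
  X = falling x
  Y = falling y

  F₁ F₂ F₃ F₄ : ℕ → ℕ → ℤ
  F₁ L M = X L * Y M
  F₂ L M = + L * X L * Y M
  F₃ L M = + M * X L * Y M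
  F₄ L M = (+ L * + M - t) * X L * Y M

  reassoc : ∀ c p q s → c * p * q * s ≡ c * (p * q * s)
  reassoc = solve-∀

  distrib : ∀ c u v w z → c * (u + v + w + z) ≡ c * u + c * v + c * w + c * z
  distrib = solve-∀

  expand : ∀ l m → C l m * X l * Y m * (x * y - t)
                   ≡ C l m * F₁ (suc l) (suc m) + C l m * F₂ l (suc m) + C l m * F₃ (suc l) m + C l m * F₄ l m
  expand l m = trans (reassoc (C l m) (X l) (Y m) (x * y - t))
                     (trans (cong (C l m *_) (falling-*[xy-t] x y l m t)) (distrib (C l m) _ _ _ _))

  regroup : ∀ a b c d p q r u v →
            (a + p * b + q * c + r * d) * u * v ≡ a * (u * v) + b * (p * u * v) + c * (q * u * v) + d * (r * u * v)
  regroup = solve-∀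

  collect : ∀ L M → C (L ℕ.∸ 1) (M ℕ.∸ 1) * F₁ L M + C L (M ℕ.∸ 1) * F₂ L M + C (L ℕ.∸ 1) M * F₃ L M + C L M * F₄ L M
                    ≡ coeffs*[xy-t] t C L M * X L * Y M
  collect L M = sym (regroup (C (L ℕ.∸ 1) (M ℕ.∸ 1)) (C L (M ℕ.∸ 1)) (C (L ℕ.∸ 1) M) (C L M)
                             (+ L) (+ M) (+ L * + M - t) (X L) (Y M))

theorem1 : (c : ℕ → ℕ → ℕ → ℤ) → IsFallingProductCoeffs c →
    ∀ (k l m : ℕ) → 1 ℕ.≤ k → l ℕ.≤ k → m ℕ.≤ k →
      c (suc k) (suc l) (suc m)
        ≡ c k l m + (+ (suc l)) * c k (suc l) m + (+ (suc m)) * c k l (suc m)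
          + ((+ (suc l)) * (+ (suc m)) - + k) * c k (suc l) (suc m)
theorem1 c (expands , supported) k l m 1≤k l≤k m≤k =
  expansion-injective (suc k) (c (suc k)) (coeffs*[xy-t] (+ k) (c k)) sameExpansion
    (suc l) (suc m) (s≤s z≤n) (s≤s l≤k) (s≤s z≤n) (s≤s m≤k)
  where
  sameExpansion : ∀ a b → expansion (suc k) (c (suc k)) (+ a) (+ b)
                          ≡ expansion (suc k) (coeffs*[xy-t] (+ k) (c k)) (+ a) (+ b)
  sameExpansion a b = begin
    expansion (suc k) (c (suc k)) x y      ≡⟨ sym (expands (suc k) (s≤s z≤n) x y) ⟩
    falling (x * y) k * (x * y - + k)      ≡⟨ cong (_* (x * y - + k)) (expands k 1≤k x y) ⟩
    expansion k (c k) x y * (x * y - + k)  ≡⟨ expansion-*[xy-t] (+ k) (supported k 1≤k) x y ⟩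
    expansion (suc k) (coeffs*[xy-t] (+ k) (c k)) x y ∎
    where
    open ≡-Reasoning
    x y : ℤ
    x = + a
    y = + b
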